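{- Let $\beta$ be a totally positive quadratic integer with minimal polynomial $x^2 - Ex + C$, where $E, C \in \mathbb{Z}_{\geq 1}$. (i) If $C \geq 2E$, then $p_\beta(E\beta^2) \geq 4$. (ii) If $C \geq 2E - 3$, then $p_\beta(E\beta^3) \geq 5$. In particular, if $C \geq 2E - 3$, it is not true that $p_\beta(E\beta^n) = n+1$ for every integer $n \geq 0$.
   Context: A quadratic integer is a root of a monic irreducible quadratic polynomial over $\mathbb{Z}$. A real quadratic $\beta$ with conjugate $\beta'$ is totally positive if $\beta > 0$ and $\beta' > 0$. For $\beta, \alpha \in \mathbb{C}$, $p_\beta(\alpha) \in \mathbb{Z}_{\geq 0}\cup\{\infty\}$ denotes the number of expressions $\alpha = a_j\beta^j + \dots + a_1\beta + a_0$ with $j, a_i \in \mathbb{Z}_{\geq 0}$ and $a_j \neq 0$; equivalently, the number of polynomials $f(x) \in \mathbb{Z}_{\geq 0}[x]$ with $f(\beta) = \alpha$. -}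

module Defs where

open import Data.Nat as ℕ using (ℕ; zero; suc)
open import Data.Integer as ℤ using (ℤ; +_)
open import Data.List using (List; []; _∷_; last)
open import Data.Maybe using (Maybe; just; nothing)
open import Data.Fin using (Fin)
open import Data.Product using (Σ; ∃; _×_; _,_)
open import Data.Empty using (⊥)
open import Data.Unit using (⊤)
open import Relation.Binary.PropositionalEquality using (_≡_)
open import Relation.Nullary using (¬_)
open import Function.Definitions using (Injective)

-- The ring ℤ[β] for β a root of the irreducible polynomial x² - E x + C,
-- realised as ℤ[x]/(x² - E x + C): the pair (a , b) stands for a + b β.
ℤ[β] : Set
ℤ[β] = ℤ × ℤ

-- multiplication by β, using β² = E β - C
mulβ : ℕ → ℕ → ℤ[β] → ℤ[β]
mulβ E C (a , b) = (ℤ.- (b ℤ.* + C)) , (a ℤ.+ b ℤ.* + E)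

-- evaluation f(β) of a polynomial with nonnegative integer coefficients,
-- given as the coefficient list [a₀ , a₁ , … , a_j] (Horner scheme)
evalβ : ℕ → ℕ → List ℕ → ℤ[β]
evalβ E C [] = (+ 0 , + 0)
evalβ E C (a ∷ as) with mulβ E C (evalβ E C as)
... | (x , y) = (+ a ℤ.+ x , y)

Eβ^ : ℕ → ℕ → ℕ → ℤ[β]
Eβ^ E C zero    = (+ E , + 0)
Eβ^ E C (suc n) = mulβ E C (Eβ^ E C n)

LeadingNonzero : List ℕ → Set
LeadingNonzero as with last as
... | nothing = ⊥
... | just a  = ¬ (a ≡ 0)

IsExpansion : ℕ → ℕ → ℤ[β] → List ℕ → Set
IsExpansion E C α f = LeadingNonzero f × (evalβ E C f ≡ α)

-- p_β(α) ≥ k : there are k pairwise distinct expansions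
AtLeast : ℕ → ℕ → ℤ[β] → ℕ → Set
AtLeast E C α k =
  Σ (Fin k → List ℕ) λ fs → Injective _≡_ _≡_ fs × (∀ i → IsExpansion E C α (fs i))

-- p_β(α) = k : k pairwise distinct expansions, and they are all of them
Exactly : ℕ → ℕ → ℤ[β] → ℕ → Set
Exactly E C α k =
  Σ (Fin k → List ℕ) λ fs → Injective _≡_ _≡_ fs × (∀ i → IsExpansion E C α (fs i))
    × (∀ f → IsExpansion E C α f → ∃ λ i → fs i ≡ f)

IrreducibleQuad : ℕ → ℕ → Set
IrreducibleQuad E C = ¬ (Σ ℤ λ a → Σ ℤ λ b → (a ℤ.+ b ≡ + E) × (a ℤ.* b ≡ + C))

-- β root of x² - E x + C (E, C ≥ 1) is a totally positive quadratic integer: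
-- irreducible, with real roots (discriminant > 0); with E, C > 0 both real
-- roots are then positive.
TotallyPositiveQuadratic : ℕ → ℕ → Set
TotallyPositiveQuadratic E C =
  (1 ℕ.≤ E) × (1 ℕ.≤ C) × IrreducibleQuad E C × (4 ℕ.* C ℕ.< E ℕ.* E)

{-# OPTIONS --safe #-}
module Submission where

-- Since β² = Eβ − C, the polynomial r = x² − Ex + C vanishes at β, so f and f + q r
-- are expansions of the same element as soon as both have nonnegative coefficients.
-- For Eβ² take E x² and x³ + Cx + n r with n = 0, 1, 2 (nonnegative when 2E ≤ C);
-- for Eβ³ take E x³ and x⁴ + Cx² + (mx + n) r with (m , n) = (0,0), (1,0), (1,1), (2,3).
-- The last needs 3E ≤ 2C besides 2E ≤ C + 3; it follows because total positivity,
-- E² > 4C ≥ 8E − 12, leaves only E ≥ 7. Five expansions of Eβ³ exclude p_β(Eβ³) = 4.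

open import Defs
open import Data.Fin using (Fin)
open import Data.Fin.Properties using (injective⇒≤)
open import Data.Integer as ℤ using (ℤ; +_)
open import Data.Integer.Properties using (pos-*; pos-+; ⊖-≥; m-n≡m⊖n; +-identityˡ; +-identityʳ)
open import Data.Integer.Tactic.RingSolver using (solve)
open import Data.List using (List; []; _∷_; map; replicate; _++_; last)
open import Data.List.Properties using (map-++; map-replicate; ∷-injectiveˡ)
open import Data.Maybe using (just)
open import Data.Nat using (ℕ; zero; suc; _+_; _*_; _∸_; _≤_; _<_; z≤n; s≤s)
open import Data.Nat.Properties
  using ( ≤-refl; ≤-reflexive; ≤-trans; <⇒≤; <⇒≱; <⇒≢; 1+n≰n; ≤ᵇ⇒≤; +-monoʳ-≤; +-monoˡ-<; +-cancelʳ-≤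
        ; *-monoˡ-≤; *-monoʳ-≤; *-cancelˡ-≤; *-identityˡ; m≤m+n; module ≤-Reasoning)
import Data.Nat.Tactic.RingSolver as ℕ-Solver
open import Data.Product using (_×_; _,_; proj₁; proj₂)
open import Data.Unit using (tt)
open import Data.Empty using (⊥-elim)
open import Function using (_∘_)
open import Relation.Binary.PropositionalEquality
open import Relation.Nullary using (¬_)

-- Unlike the pair type ℤ[β], this type has no η-rule, so evaluating a concrete list
-- reduces to ⟨ p , q ⟩ with p and q polynomial expressions that the ring solver can read.
data ℤβ : Set where
  ⟨_,_⟩ : ℤ → ℤ → ℤβ

toℤ[β] : ℤβ → ℤ[β]
toℤ[β] ⟨ a , b ⟩ = (a , b)

mulβℤ : ℤ → ℤ → ℤβ → ℤβ
mulβℤ e c ⟨ a , b ⟩ = ⟨ ℤ.- (b ℤ.* c) , a ℤ.+ b ℤ.* e ⟩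

evalβℤ : ℤ → ℤ → List ℤ → ℤβ
evalβℤ e c [] = ⟨ + 0 , + 0 ⟩
evalβℤ e c (a ∷ as) with mulβℤ e c (evalβℤ e c as)
... | ⟨ x , y ⟩ = ⟨ a ℤ.+ x , y ⟩

Eβ^ℤ : ℤ → ℤ → ℕ → ℤβ
Eβ^ℤ e c zero    = ⟨ e , + 0 ⟩
Eβ^ℤ e c (suc n) = mulβℤ e c (Eβ^ℤ e c n)

toℤ[β]-mulβℤ : ∀ E C v → toℤ[β] (mulβℤ (+ E) (+ C) v) ≡ mulβ E C (toℤ[β] v)
toℤ[β]-mulβℤ E C ⟨ a , b ⟩ = refl

evalβ≡evalβℤ : ∀ E C f → evalβ E C f ≡ toℤ[β] (evalβℤ (+ E) (+ C) (map +_ f))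
evalβ≡evalβℤ E C []      = refl
evalβ≡evalβℤ E C (a ∷ f) with evalβℤ (+ E) (+ C) (map +_ f) | evalβ≡evalβℤ E C f
... | ⟨ x , y ⟩ | refl = refl

Eβ^≡Eβ^ℤ : ∀ E C n → Eβ^ E C n ≡ toℤ[β] (Eβ^ℤ (+ E) (+ C) n)
Eβ^≡Eβ^ℤ E C zero    = refl
Eβ^≡Eβ^ℤ E C (suc n) =
  trans (cong (mulβ E C) (Eβ^≡Eβ^ℤ E C n)) (sym (toℤ[β]-mulβℤ E C (Eβ^ℤ (+ E) (+ C) n)))

evalβℤ-shift : ∀ e c f → evalβℤ e c (+ 0 ∷ f) ≡ mulβℤ e c (evalβℤ e c f)
evalβℤ-shift e c f with mulβℤ e c (evalβℤ e c f)
... | ⟨ x , y ⟩ = cong ⟨_, y ⟩ (+-identityˡ x)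

evalβℤ-monomial : ∀ e c n → evalβℤ e c (replicate n (+ 0) ++ e ∷ []) ≡ Eβ^ℤ e c n
evalβℤ-monomial e c zero    = cong ⟨_, + 0 ⟩ (+-identityʳ e)
evalβℤ-monomial e c (suc n) =
  trans (evalβℤ-shift e c (replicate n (+ 0) ++ e ∷ []))
        (cong (mulβℤ e c) (evalβℤ-monomial e c n))

evalβℤ-cubic : ∀ e c n {a₀ a₁} → a₀ ≡ n ℤ.* c → a₁ ≡ c ℤ.- n ℤ.* e →
  evalβℤ e c (a₀ ∷ a₁ ∷ n ∷ + 1 ∷ []) ≡ Eβ^ℤ e c 2
evalβℤ-cubic e c n refl refl =
  cong₂ ⟨_,_⟩ (solve (e ∷ c ∷ n ∷ [])) (solve (e ∷ c ∷ n ∷ []))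

evalβℤ-quartic : ∀ e c m n {a₀ a₁ a₂} →
  a₀ ≡ n ℤ.* c → a₁ ≡ m ℤ.* c ℤ.- n ℤ.* e → a₂ ≡ c ℤ.+ n ℤ.- m ℤ.* e →
  evalβℤ e c (a₀ ∷ a₁ ∷ a₂ ∷ m ∷ + 1 ∷ []) ≡ Eβ^ℤ e c 3
evalβℤ-quartic e c m n refl refl refl =
  cong₂ ⟨_,_⟩ (solve (e ∷ c ∷ m ∷ n ∷ [])) (solve (e ∷ c ∷ m ∷ n ∷ []))

pos-∸ : ∀ {m n} → n ≤ m → + (m ∸ n) ≡ + m ℤ.- + n
pos-∸ {m} {n} n≤m = trans (sym (⊖-≥ n≤m)) (sym (m-n≡m⊖n m n))

last-++-singleton : ∀ {A : Set} (xs : List A) x → last (xs ++ x ∷ []) ≡ just x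
last-++-singleton []           x = refl
last-++-singleton (_ ∷ [])     x = refl
last-++-singleton (_ ∷ _ ∷ xs) x = last-++-singleton (_ ∷ xs) x

module Expansions (E C : ℕ) where

  monomial : ℕ → List ℕ
  monomial n = replicate n 0 ++ E ∷ []

  -- x³ + Cx + n (x² − Ex + C)
  cubic : ℕ → List ℕ
  cubic n = n * C ∷ C ∸ n * E ∷ n ∷ 1 ∷ []

  -- x⁴ + Cx² + (mx + n) (x² − Ex + C)
  quartic : ℕ → ℕ → List ℕ
  quartic m n = n * C ∷ m * C ∸ n * E ∷ C + n ∸ m * E ∷ m ∷ 1 ∷ []

  monomial-expansion : 1 ≤ E → ∀ n → IsExpansion E C (Eβ^ E C n) (monomial n)
  monomial-expansion 1≤E n = leading-nonzero , (begin
    evalβ E C (monomial n)                                      ≡⟨ evalβ≡evalβℤ E C (monomial n) ⟩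
    toℤ[β] (evalβℤ (+ E) (+ C) (map +_ (monomial n)))           ≡⟨ cong (toℤ[β] ∘ evalβℤ (+ E) (+ C)) map-monomial ⟩
    toℤ[β] (evalβℤ (+ E) (+ C) (replicate n (+ 0) ++ + E ∷ [])) ≡⟨ cong toℤ[β] (evalβℤ-monomial (+ E) (+ C) n) ⟩
    toℤ[β] (Eβ^ℤ (+ E) (+ C) n)                                 ≡⟨ Eβ^≡Eβ^ℤ E C n ⟨
    Eβ^ E C n                                                   ∎)
    where
    open ≡-Reasoning
    leading-nonzero : LeadingNonzero (monomial n)
    leading-nonzero rewrite last-++-singleton (replicate n 0) E = <⇒≢ 1≤E ∘ sym
    map-monomial : map +_ (monomial n) ≡ replicate n (+ 0) ++ + E ∷ []
    map-monomial = trans (map-++ +_ (replicate n 0) (E ∷ []))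
                         (cong (_++ + E ∷ []) (map-replicate +_ n 0))

  cubic-expansion : ∀ n → n * E ≤ C → IsExpansion E C (Eβ^ E C 2) (cubic n)
  cubic-expansion n nE≤C = (λ ()) ,
    trans (evalβ≡evalβℤ E C (cubic n))
          (cong toℤ[β] (evalβℤ-cubic (+ E) (+ C) (+ n) (pos-* n C)
            (trans (pos-∸ nE≤C) (cong (λ x → + C ℤ.- x) (pos-* n E)))))

  quartic-expansion : ∀ m n → n * E ≤ m * C → m * E ≤ C + n →
    IsExpansion E C (Eβ^ E C 3) (quartic m n)
  quartic-expansion m n nE≤mC mE≤C+n = (λ ()) ,
    trans (evalβ≡evalβℤ E C (quartic m n))
          (cong toℤ[β] (evalβℤ-quartic (+ E) (+ C) (+ m) (+ n) (pos-* n C)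
            (trans (pos-∸ nE≤mC) (cong₂ ℤ._-_ (pos-* m C) (pos-* n E)))
            (trans (pos-∸ mE≤C+n) (cong₂ ℤ._-_ (pos-+ C n) (pos-* m E)))))

8E<E²+12 : ∀ {E C} → 4 * C < E * E → 2 * E ≤ C + 3 → 8 * E < E * E + 12
8E<E²+12 {E} {C} disc 2E≤C+3 = begin-strict
  8 * E         ≡⟨ ℕ-Solver.solve (E ∷ []) ⟩
  4 * (2 * E)   ≤⟨ *-monoʳ-≤ 4 2E≤C+3 ⟩
  4 * (C + 3)   ≡⟨ ℕ-Solver.solve (C ∷ []) ⟩
  4 * C + 12    <⟨ +-monoˡ-< 12 disc ⟩
  E * E + 12    ∎
  where open ≤-Reasoning

7≤E : ∀ {E C} → 1 ≤ C → 4 * C < E * E → 2 * E ≤ C + 3 → 7 ≤ E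
7≤E {E} {C} 1≤C disc 2E≤C+3 = go E 1≤C disc (8E<E²+12 {E} {C} disc 2E≤C+3)
  where
  go : ∀ E {C} → 1 ≤ C → 4 * C < E * E → 8 * E < E * E + 12 → 7 ≤ E
  go 0 _          ()       _
  go 1 (s≤s z≤n) (s≤s ()) _
  go 2 _ _ key = ⊥-elim (<⇒≱ key (≤ᵇ⇒≤ _ _ tt))
  go 3 _ _ key = ⊥-elim (<⇒≱ key (≤ᵇ⇒≤ _ _ tt))
  go 4 _ _ key = ⊥-elim (<⇒≱ key (≤ᵇ⇒≤ _ _ tt))
  go 5 _ _ key = ⊥-elim (<⇒≱ key (≤ᵇ⇒≤ _ _ tt))
  go 6 _ _ key = ⊥-elim (<⇒≱ key (≤ᵇ⇒≤ _ _ tt))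
  go (suc (suc (suc (suc (suc (suc (suc _))))))) _ _ _ = s≤s (s≤s (s≤s (s≤s (s≤s (s≤s (s≤s z≤n))))))

7≤E⇒3E≤2C : ∀ {E C} → 7 ≤ E → 2 * E ≤ C + 3 → 3 * E ≤ 2 * C
7≤E⇒3E≤2C {E} {C} 7≤E 2E≤C+3 = +-cancelʳ-≤ 6 (3 * E) (2 * C) (begin
  3 * E + 6     ≤⟨ +-monoʳ-≤ (3 * E) (<⇒≤ 7≤E) ⟩
  3 * E + E     ≡⟨ ℕ-Solver.solve (E ∷ []) ⟩
  2 * (2 * E)   ≤⟨ *-monoʳ-≤ 2 2E≤C+3 ⟩
  2 * (C + 3)   ≡⟨ ℕ-Solver.solve (C ∷ []) ⟩
  2 * C + 6     ∎)
  where open ≤-Reasoning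

3E≤2C⇒E≤C : ∀ {E C} → 3 * E ≤ 2 * C → E ≤ C
3E≤2C⇒E≤C {E} {C} 3E≤2C = *-cancelˡ-≤ 3 (≤-trans 3E≤2C (*-monoˡ-≤ C {2} {3} (s≤s (s≤s z≤n))))

-- Imported only now: with the constructors of Vec, All and AllPairs in scope, the
-- variable lists handed to the ring solvers above become ambiguous and elaboration blows up.
open import Data.Vec using (Vec; []; _∷_; lookup)
open import Data.Vec.Relation.Unary.All using (All; []; _∷_)
open import Data.Vec.Relation.Unary.All.Properties using (lookup⁺)
open import Data.Vec.Relation.Unary.AllPairs using ([]; _∷_)
open import Data.Vec.Relation.Unary.Unique.Propositional using (Unique)
open import Data.Vec.Relation.Unary.Unique.Propositional.Properties using (lookup-injective)

AtLeast-of-Unique : ∀ {E C α k} (fs : Vec (List ℕ) k) → Unique fs →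
  All (IsExpansion E C α) fs → AtLeast E C α k
AtLeast-of-Unique fs unique expansions =
  lookup fs , lookup-injective unique _ _ , lookup⁺ expansions

AtLeast≤Exactly : ∀ {E C α} {m k} → AtLeast E C α m → Exactly E C α k → m ≤ k
AtLeast≤Exactly {m = m} {k} (gs , gs-injective , gs-expansions) (fs , _ , _ , fs-complete) =
  injective⇒≤ index-injective
  where
  open ≡-Reasoning
  index : Fin m → Fin k
  index i = proj₁ (fs-complete (gs i) (gs-expansions i))
  fs∘index≡gs : ∀ i → fs (index i) ≡ gs i
  fs∘index≡gs i = proj₂ (fs-complete (gs i) (gs-expansions i))
  index-injective : ∀ {i j} → index i ≡ index j → i ≡ j
  index-injective {i} {j} eq = gs-injective (begin
    gs i          ≡⟨ fs∘index≡gs i ⟨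
    fs (index i)  ≡⟨ cong fs eq ⟩
    fs (index j)  ≡⟨ fs∘index≡gs j ⟩
    gs j          ∎)

Eβ²-four-expansions : ∀ {E C} → 1 ≤ E → 2 * E ≤ C → AtLeast E C (Eβ^ E C 2) 4
Eβ²-four-expansions {E} {C} 1≤E 2E≤C =
  AtLeast-of-Unique (monomial 2 ∷ cubic 0 ∷ cubic 1 ∷ cubic 2 ∷ [])
    (((λ ()) ∷ (λ ()) ∷ (λ ()) ∷ []) ∷ ((λ ()) ∷ (λ ()) ∷ []) ∷ ((λ ()) ∷ []) ∷ [] ∷ [])
    (monomial-expansion 1≤E 2 ∷ cubic′ 0 z≤n ∷ cubic′ 1 (s≤s z≤n) ∷ cubic′ 2 ≤-refl ∷ [])
  where
  open Expansions E C
  cubic′ : ∀ n → n ≤ 2 → IsExpansion E C (Eβ^ E C 2) (cubic n)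
  cubic′ n n≤2 = cubic-expansion n (≤-trans (*-monoˡ-≤ E n≤2) 2E≤C)

Eβ³-five-expansions : ∀ {E C} → 1 ≤ E → 1 ≤ C → 4 * C < E * E → 2 * E ≤ C + 3 →
  AtLeast E C (Eβ^ E C 3) 5
Eβ³-five-expansions {E} {C} 1≤E 1≤C disc 2E≤C+3 =
  AtLeast-of-Unique (monomial 3 ∷ quartic 0 0 ∷ quartic 1 0 ∷ quartic 1 1 ∷ quartic 2 3 ∷ [])
    ( ((λ ()) ∷ (λ ()) ∷ (λ ()) ∷ (λ ()) ∷ [])
    ∷ ((λ ()) ∷ (λ ()) ∷ (λ ()) ∷ [])
    ∷ (different-constant-terms ∷ (λ ()) ∷ [])
    ∷ ((λ ()) ∷ []) ∷ [] ∷ [])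
    ( monomial-expansion 1≤E 3
    ∷ quartic-expansion 0 0 z≤n z≤n
    ∷ quartic-expansion 1 0 z≤n (E≤C+ 0)
    ∷ quartic-expansion 1 1 (*-monoʳ-≤ 1 E≤C) (E≤C+ 1)
    ∷ quartic-expansion 2 3 3E≤2C 2E≤C+3
    ∷ [])
  where
  open Expansions E C
  3E≤2C : 3 * E ≤ 2 * C
  3E≤2C = 7≤E⇒3E≤2C (7≤E {E} 1≤C disc 2E≤C+3) 2E≤C+3
  E≤C : E ≤ C
  E≤C = 3E≤2C⇒E≤C 3E≤2C
  E≤C+_ : ∀ n → 1 * E ≤ C + n
  E≤C+ n = ≤-trans (≤-trans (≤-reflexive (*-identityˡ E)) E≤C) (m≤m+n C n)
  different-constant-terms : quartic 1 0 ≢ quartic 1 1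
  different-constant-terms eq = <⇒≢ 1≤C (trans (∷-injectiveˡ eq) (*-identityˡ C))

proposition12 : (E C : ℕ) → TotallyPositiveQuadratic E C →
    ((2 * E ≤ C → AtLeast E C (Eβ^ E C 2) 4)
    × (2 * E ≤ C + 3 → AtLeast E C (Eβ^ E C 3) 5)
    × (2 * E ≤ C + 3 → ¬ (∀ n → Exactly E C (Eβ^ E C n) (suc n))))
proposition12 E C (1≤E , 1≤C , _ , disc) =
    Eβ²-four-expansions 1≤E
  , five
  , λ 2E≤C+3 exact → 1+n≰n (AtLeast≤Exactly (five 2E≤C+3) (exact 3))
  where
  five : 2 * E ≤ C + 3 → AtLeast E C (Eβ^ E C 3) 5
  five = Eβ³-five-expansions 1≤E 1≤C disc
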